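{- Let $(G,Z,k)$ be a yes-instance of Disjoint $d$-quasi-forest deletion. Then there are at most $2(k+1)+d$ connected components of $G - Z$ that have at least $d+2$ neighbors in $Z$.
   Context: A $d$-quasi-forest is a graph in which each connected component admits a feedback vertex set of size at most $d$. Disjoint $d$-quasi-forest deletion: the input is a graph $G$, an integer $k$, and a set $Z \subseteq V(G)$ with $|Z| \le k+1$ such that $G - Z$ is a $d$-quasi-forest ($d$ fixed); it is a yes-instance iff there is $X \subseteq V(G)$ with $|X| \le k$ and $X \cap Z = \emptyset$ such that $G - X$ is a $d$-quasi-forest. The neighbors in $Z$ of a component $C$ are the vertices of $Z$ adjacent to some vertex of $C$. -}

module Defs where

open import Data.Nat using (ℕ; zero; suc; _≤_; _+_; _*_)
open import Data.Fin using (Fin; zero; suc; inject₁; fromℕ)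
open import Data.Fin.Subset using (Subset; _∈_; _∉_; ∣_∣)
open import Data.Product using (Σ; _×_; _,_)
open import Relation.Nullary using (¬_)
open import Relation.Binary.PropositionalEquality using (_≡_)

record Graph : Set₁ where
  field
    n      : ℕ
    Adj    : Fin n → Fin n → Set
    sym    : ∀ {u v} → Adj u v → Adj v u
    irrefl : ∀ {v} → ¬ Adj v v
open Graph public

-- A vertex set given as a predicate; G[S] denotes the induced subgraph.
VSet : Graph → Set₁
VSet G = Fin (n G) → Set

data Reach (G : Graph) (S : VSet G) (u : Fin (n G)) : Fin (n G) → Set where
  here : S u → Reach G S u u
  step : ∀ {v w} → Reach G S u v → Adj G v w → S w → Reach G S u w

Component : (G : Graph) → VSet G → Fin (n G) → VSet G
Component G S v u = Reach G S v u

-- A cycle in G[T]: distinct vertices c 0, …, c m (m ≥ 2, so length ≥ 3),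
-- all in T, consecutive ones adjacent, and c m adjacent to c 0.
record Cycle (G : Graph) (T : VSet G) : Set where
  field
    m       : ℕ
    m≥2     : 2 ≤ m
    c       : Fin (suc m) → Fin (n G)
    inj     : ∀ i j → c i ≡ c j → i ≡ j
    inT     : ∀ i → T (c i)
    adj     : ∀ (i : Fin m) → Adj G (c (inject₁ i)) (c (suc i))
    closing : Adj G (c (fromℕ m)) (c zero)

Forest : (G : Graph) → VSet G → Set
Forest G T = ¬ Cycle G T

HasFVS : ℕ → (G : Graph) → VSet G → Set
HasFVS d G C = Σ (Subset (n G)) λ F →
  (∀ x → x ∈ F → C x) × ∣ F ∣ ≤ d × Forest G (λ u → C u × u ∉ F)

QuasiForest : ℕ → (G : Graph) → VSet G → Set
QuasiForest d G S = ∀ v → S v → HasFVS d G (Component G S v)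

Minus : (G : Graph) → Subset (n G) → VSet G
Minus G X v = v ∉ X

YesInstance : ℕ → (G : Graph) → Subset (n G) → ℕ → Set
YesInstance d G Z k = Σ (Subset (n G)) λ X →
  ∣ X ∣ ≤ k × (∀ x → x ∈ X → x ∉ Z) × QuasiForest d G (Minus G X)

AtLeastNbrsIn : (G : Graph) → VSet G → Fin (n G) → Subset (n G) → ℕ → Set
AtLeastNbrsIn G S v Z t = Σ (Subset (n G)) λ N →
  (∀ z → z ∈ N → z ∈ Z) × t ≤ ∣ N ∣ ×
  (∀ z → z ∈ N → Σ (Fin (n G)) λ u → Component G S v u × Adj G z u)

module Submission where

-- With a solution X
-- (|X| ≤ k, X ∩ Z = ∅, G - X a d-quasi-forest) we prove the stronger bound m ≤ |X| + |Z|.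
--   * A component meeting X contains a vertex of X of its own: at most |X| such components.
--   * The others lie in G - X; group them by the component Γ of G - X containing them.  Let F
--     be a feedback vertex set of Γ, |F| ≤ d, with b vertices outside Z.  At most b components
--     of Γ meet F.  The other ones, say c, hang off the forest Γ - F, each with ≥ b + 2
--     neighbours in Z ∩ Γ - F; contracting them keeps a forest, so c(b + 1) ≤ |Z ∩ Γ|.  As also
--     b ≤ d ≤ |Z ∩ Γ|, the components in Γ number at most |Z ∩ Γ|.  Reachability is not decidable
-- constructively, but the conclusion is, so we may assume decidability classically.

open import Defs
open import Data.Nat using (ℕ; suc; _≤_; _+_; _*_)
open import Data.Fin using (Fin)
open import Data.Fin.Subset using (Subset; _∉_; ∣_∣)
open import Relation.Binary.PropositionalEquality using (_≡_)

open import Data.Nat using (zero; _<_; z≤n; s≤s; _≤?_)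
open import Data.Nat.Properties
  using (≤-refl; ≤-trans; ≤-reflexive; ≤-pred; n≮0; m<n+m; n≤1+n; m≤n+m; m≤m+n; m+n≤o⇒n≤o;
         +-mono-≤; +-monoˡ-≤; +-monoʳ-≤; +-cancelˡ-≤; +-identityʳ; +-suc; m≤m*n;
         +-commutativeSemigroup; module ≤-Reasoning)
import Data.Nat.Properties as ℕ
open import Algebra.Properties.CommutativeSemigroup +-commutativeSemigroup using (interchange)
open import Data.Fin using (zero; suc; inject₁; fromℕ; _≟_)
import Data.Fin.Properties as Fin
open import Data.Fin.Properties using (any?)
open import Data.Fin.Subset using (_∈_)
open import Data.Fin.Subset.Properties using (_∈?_)
open import Data.Bool using (Bool; true; false; T; _∧_; not; if_then_else_)
open import Data.Bool.Properties using (T-∧; T-≡; ∧-identityʳ)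
open import Data.Vec using ([]; _∷_)
open import Data.List using (List; []; _∷_; _++_; length; lookup)
open import Data.List.Properties using (length-++)
open import Data.List.Membership.Propositional using () renaming (_∈_ to _∈ᴸ_)
open import Data.List.Membership.Propositional.Properties using (∈-lookup)
open import Data.List.Relation.Unary.Any using (here; there)
open import Data.List.Relation.Unary.All using ([]) renaming (lookup to All-lookup)
open import Data.List.Relation.Unary.All.Properties using (¬Any⇒All¬)
open import Data.List.Relation.Unary.Unique.Propositional using (Unique; []; _∷_)
open import Data.List.Relation.Unary.Unique.Propositional.Properties using (++⁺)
open import Data.Unit using (tt)
open import Data.Empty using (⊥; ⊥-elim)
open import Data.Sum using (_⊎_; inj₁; inj₂)
open import Data.Product using (∃; _×_; _,_; proj₁; proj₂)
open import Function using (_∘_; id; Equivalence)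
open import Relation.Nullary using (¬_; Dec; yes; no; does)
open import Relation.Nullary.Decidable using (T?; _×-dec_; decidable-stable; ¬¬-excluded-middle)
open import Relation.Binary using (Decidable; Symmetric; Transitive)
open import Relation.Binary.PropositionalEquality
  using (_≢_; refl; trans; cong; cong₂; subst; module ≡-Reasoning) renaming (sym to ≡-sym)

does-sound : ∀ {A : Set} (a? : Dec A) → T (does a?) → A
does-sound (yes a) _ = a

does-complete : ∀ {A : Set} (a? : Dec A) → A → T (does a?)
does-complete (yes _) _  = tt
does-complete (no ¬a) a = ¬a a

T-not⁻ : ∀ {a} → T (not a) → ¬ T a
T-not⁻ {false} _ ()

T-not⁺ : ∀ {a} → ¬ T a → T (not a)
T-not⁺ {true}  ¬a = ¬a tt
T-not⁺ {false} _  = tt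

BPred : ℕ → Set
BPred n = Fin n → Bool

module _ {n : ℕ} where

  _⊆_ : BPred n → BPred n → Set
  p ⊆ q = ∀ i → T (p i) → T (q i)

  ⁅_⁆ : Fin n → BPred n
  ⁅ j ⁆ i = does (i ≟ j)

indicator : Bool → ℕ
indicator true  = 1
indicator false = 0

count : ∀ {n} → BPred n → ℕ
count {zero}  p = 0
count {suc n} p = indicator (p zero) + count (p ∘ suc)

count-cong : ∀ {n} {p q : BPred n} → (∀ i → p i ≡ q i) → count p ≡ count q
count-cong {zero}  eq = refl
count-cong {suc n} eq = cong₂ _+_ (cong indicator (eq zero)) (count-cong (eq ∘ suc))

count-mono : ∀ {n} {p q : BPred n} → p ⊆ q → count p ≤ count q
count-mono {zero}          p⊆q = z≤n
count-mono {suc n} {p} {q} p⊆q =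
  +-mono-≤ (indicator-mono (p zero) (q zero) (p⊆q zero)) (count-mono (p⊆q ∘ suc))
  where
  indicator-mono : ∀ a b → (T a → T b) → indicator a ≤ indicator b
  indicator-mono false _     _   = z≤n
  indicator-mono true  true  _   = s≤s z≤n
  indicator-mono true  false a⇒b = ⊥-elim (a⇒b tt)

count-complement : ∀ {n} (p : BPred n) → n ≡ count p + count (not ∘ p)
count-complement {zero}  p = refl
count-complement {suc n} p with p zero
... | true  = cong suc (count-complement (p ∘ suc))
... | false = trans (cong suc (count-complement (p ∘ suc))) (≡-sym (+-suc _ _))

count-witness : ∀ {n} (p : BPred n) → 0 < count p → ∃ λ i → T (p i)
count-witness {suc n} p pos with p zero in eq
... | true  = zero , Equivalence.from T-≡ eq
... | false with count-witness (p ∘ suc) pos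
...   | i , pi = suc i , pi

count-zero-or-witness : ∀ {n} (p : BPred n) → count p ≡ 0 ⊎ ∃ λ i → T (p i)
count-zero-or-witness p with count p in eq
... | zero  = inj₁ refl
... | suc _ = inj₂ (count-witness p (subst (0 <_) (≡-sym eq) (s≤s z≤n)))

-- Intersection and difference are opaque, so that the membership lemmas below can infer
-- which sets they are about; only the two counting laws need their definitions.
opaque
  _∩_ _∖_ : ∀ {n} → BPred n → BPred n → BPred n
  (p ∩ q) i = p i ∧ q i
  (p ∖ q) i = p i ∧ not (q i)

  infixl 7 _∩_ _∖_

  ∩⁻ : ∀ {n} {p q : BPred n} {i} → T ((p ∩ q) i) → T (p i) × T (q i)
  ∩⁻ {p = p} {q} {i} = Equivalence.to (T-∧ {p i} {q i})

  ∩⁺ : ∀ {n} {p q : BPred n} {i} → T (p i) → T (q i) → T ((p ∩ q) i)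
  ∩⁺ {p = p} {q} {i} pi qi = Equivalence.from (T-∧ {p i} {q i}) (pi , qi)

  ∖⁻ : ∀ {n} {p q : BPred n} {i} → T ((p ∖ q) i) → T (p i) × ¬ T (q i)
  ∖⁻ {p = p} {q} {i} pq with Equivalence.to (T-∧ {p i} {not (q i)}) pq
  ... | pi , ¬qi = pi , T-not⁻ ¬qi

  ∖⁺ : ∀ {n} {p q : BPred n} {i} → T (p i) → ¬ T (q i) → T ((p ∖ q) i)
  ∖⁺ {p = p} {q} {i} pi ¬qi = Equivalence.from (T-∧ {p i} {not (q i)}) (pi , T-not⁺ ¬qi)

  count-split : ∀ {n} (p q : BPred n) → count p ≡ count (p ∩ q) + count (p ∖ q)
  count-split {zero}  p q = refl
  count-split {suc n} p q = begin
    indicator (p zero) + count (p ∘ suc)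
      ≡⟨ cong₂ _+_ (indicator-split (p zero) (q zero)) (count-split (p ∘ suc) (q ∘ suc)) ⟩
    (indicator (p zero ∧ q zero) + indicator (p zero ∧ not (q zero)))
      + (count ((p ∩ q) ∘ suc) + count ((p ∖ q) ∘ suc))
      ≡⟨ interchange (indicator (p zero ∧ q zero)) (indicator (p zero ∧ not (q zero))) _ _ ⟩
    count (p ∩ q) + count (p ∖ q) ∎
    where
    open ≡-Reasoning
    indicator-split : ∀ a b → indicator a ≡ indicator (a ∧ b) + indicator (a ∧ not b)
    indicator-split true  true  = refl
    indicator-split true  false = refl
    indicator-split false _     = refl

  -- Removing a member lowers the count by one (for j = zero: b ∧ not false = b).
  count-remove : ∀ {n} (p : BPred n) {j} → T (p j) → count p ≡ suc (count (p ∖ ⁅ j ⁆))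
  count-remove {suc n} p {zero} pj with p zero
  ... | true = cong suc (count-cong (λ i → ≡-sym (∧-identityʳ (p (suc i)))))
  count-remove {suc n} p {suc j} pj with p zero
  ... | true  = cong suc (count-remove (p ∘ suc) pj)
  ... | false = count-remove (p ∘ suc) pj

count-injection : ∀ {n n′} (A : BPred n) (B : BPred n′) (R : Fin n → Fin n′ → Set) →
  (∀ i → T (A i) → ∃ λ j → T (B j) × R i j) →
  (∀ {i i′ j} → T (A i) → T (A i′) → R i j → R i′ j → i ≡ i′) →
  count A ≤ count B
count-injection {zero}  A B R image injective = z≤n
count-injection {suc n} A B R image injective with A zero in eq
... | false = count-injection (A ∘ suc) B (R ∘ suc) (image ∘ suc)
                (λ a a′ r r′ → Fin.suc-injective (injective a a′ r r′))
... | true with image zero (Equivalence.from T-≡ eq)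
...   | j₀ , Bj₀ , Rj₀ = subst (suc (count (A ∘ suc)) ≤_) (≡-sym (count-remove B Bj₀))
          (s≤s (count-injection (A ∘ suc) (B ∖ ⁅ j₀ ⁆) (R ∘ suc) image′
                  (λ a a′ r r′ → Fin.suc-injective (injective a a′ r r′))))
  where
  image′ : ∀ i → T (A (suc i)) → ∃ λ j → T ((B ∖ ⁅ j₀ ⁆) j) × R (suc i) j
  image′ i a with image (suc i) a
  ... | j , Bj , Rj = j , ∖⁺ Bj j≢j₀ , Rj
    where
    j≢j₀ : ¬ T (does (j ≟ j₀))
    j≢j₀ t with does-sound (j ≟ j₀) t
    ... | refl with injective (Equivalence.from T-≡ eq) a Rj₀ Rj
    ...   | ()

-- If each A-index i satisfies r i ∼ r i, and the class of r i holds
-- at most as many A-indices (through r) as B-points, then |A| ≤ |B|: the classes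
-- partition both sides.
module _ {m N : ℕ} (r : Fin m → Fin N) {_∼_ : Fin N → Fin N → Set} (_∼?_ : Decidable _∼_)
         (∼-sym : Symmetric _∼_) (∼-trans : Transitive _∼_) where

  class : Fin N → BPred N
  class x y = does (x ∼? y)

  ClassBound : BPred m → BPred N → Set
  ClassBound A B = ∀ i → T (A i) → count (A ∩ (class (r i) ∘ r)) ≤ count (B ∩ class (r i))

  module _ (A : BPred m) (B : BPred N) (i₀ : Fin m) where

    A⁻ : BPred m
    A⁻ = A ∖ (class (r i₀) ∘ r)

    B⁻ : BPred N
    B⁻ = B ∖ class (r i₀)

    outside-class : ∀ {x y} → ¬ T (class (r i₀) x) → y ∼ x → ¬ T (class (r i₀) y)
    outside-class {x} {y} x∉ y∼x i₀∼y =
      x∉ (does-complete (r i₀ ∼? x) (∼-trans (does-sound (r i₀ ∼? y) i₀∼y) y∼x))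

    class-nonempty : T (A i₀) → r i₀ ∼ r i₀ → count A⁻ < count A
    class-nonempty a₀ i₀∼i₀ = begin-strict
      count A⁻                                   <⟨ m<n+m (count A⁻) A₁-nonempty ⟩
      count (A ∩ (class (r i₀) ∘ r)) + count A⁻  ≡⟨ count-split A (class (r i₀) ∘ r) ⟨
      count A                                    ∎
      where
      open ≤-Reasoning
      A₁-nonempty : 0 < count (A ∩ (class (r i₀) ∘ r))
      A₁-nonempty = subst (0 <_) (≡-sym (count-remove (A ∩ (class (r i₀) ∘ r)) i₀∈A₁)) (s≤s z≤n)
        where
        i₀∈A₁ : T ((A ∩ (class (r i₀) ∘ r)) i₀)
        i₀∈A₁ = ∩⁺ a₀ (does-complete (r i₀ ∼? r i₀) i₀∼i₀)

    class-bound⁻ : ClassBound A B → ClassBound A⁻ B⁻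
    class-bound⁻ bound i a⁻ = begin
      count (A⁻ ∩ (class (r i) ∘ r))  ≤⟨ count-mono shrink-A ⟩
      count (A ∩ (class (r i) ∘ r))   ≤⟨ bound i (proj₁ (∖⁻ a⁻)) ⟩
      count (B ∩ class (r i))         ≤⟨ count-mono keep-B ⟩
      count (B⁻ ∩ class (r i))        ∎
      where
      open ≤-Reasoning
      shrink-A : (A⁻ ∩ (class (r i) ∘ r)) ⊆ (A ∩ (class (r i) ∘ r))
      shrink-A j a⁻∩ = ∩⁺ (proj₁ (∖⁻ (proj₁ (∩⁻ a⁻∩)))) (proj₂ (∩⁻ a⁻∩))
      -- The class of r i is disjoint from the removed class, as r i lies outside it.
      keep-B : (B ∩ class (r i)) ⊆ (B⁻ ∩ class (r i))
      keep-B z b∩ = ∩⁺ (∖⁺ (proj₁ (∩⁻ b∩)) (outside-class (proj₂ (∖⁻ a⁻)) z∼i)) (proj₂ (∩⁻ b∩))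
        where
        z∼i : z ∼ r i
        z∼i = ∼-sym (does-sound (r i ∼? z) (proj₂ (∩⁻ b∩)))

    add-class : ClassBound A B → T (A i₀) → count A⁻ ≤ count B⁻ → count A ≤ count B
    add-class bound a₀ rest = begin
      count A                                                 ≡⟨ count-split A (class (r i₀) ∘ r) ⟩
      count (A ∩ (class (r i₀) ∘ r)) + count A⁻               ≤⟨ +-mono-≤ (bound i₀ a₀) rest ⟩
      count (B ∩ class (r i₀)) + count B⁻                     ≡⟨ count-split B (class (r i₀)) ⟨
      count B                                                 ∎
      where open ≤-Reasoning

  count-by-classes : (A : BPred m) (B : BPred N) → (∀ i → T (A i) → r i ∼ r i) →
    ClassBound A B → count A ≤ count B
  count-by-classes A B = peel (count A) A B ≤-refl
    where
    -- Peel off one class at a time; K bounds the number of A-indices left.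
    peel : ∀ K A B → count A ≤ K → (∀ i → T (A i) → r i ∼ r i) → ClassBound A B → count A ≤ count B
    peel K A B size A-refl bound with count-zero-or-witness A
    ... | inj₁ empty = subst (_≤ count B) (≡-sym empty) z≤n
    peel zero A B size A-refl bound | inj₂ (i₀ , a₀) =
      ⊥-elim (n≮0 (≤-trans (class-nonempty A B i₀ a₀ (A-refl i₀ a₀)) size))
    peel (suc K) A B size A-refl bound | inj₂ (i₀ , a₀) =
      add-class A B i₀ bound a₀
        (peel K (A⁻ A B i₀) (B⁻ A B i₀)
              (≤-pred (≤-trans (class-nonempty A B i₀ a₀ (A-refl i₀ a₀)) size))
              (λ i a⁻ → A-refl i (proj₁ (∖⁻ a⁻)))
              (class-bound⁻ A B i₀ bound))

⟦_⟧ : ∀ {k} → Subset k → BPred k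
⟦ p ⟧ x = does (x ∈? p)

∣∣≡count : ∀ {k} (p : Subset k) → ∣ p ∣ ≡ count ⟦ p ⟧
∣∣≡count []          = refl
∣∣≡count (true ∷ p)  = cong suc (∣∣≡count p)
∣∣≡count (false ∷ p) = ∣∣≡count p

sum-bound : ∀ {h c e s} → h ≤ e → e ≤ s → c * suc e ≤ s → h + c ≤ s
sum-bound {h} {zero}  h≤e e≤s _ = ≤-trans (≤-reflexive (+-identityʳ h)) (≤-trans h≤e e≤s)
sum-bound {h} {suc c} {e} {s} h≤e _ c·e≤s = begin
  h + suc c          ≤⟨ +-monoˡ-≤ (suc c) h≤e ⟩
  e + suc c          ≡⟨ +-suc e c ⟩
  suc e + c          ≤⟨ +-monoʳ-≤ (suc e) (m≤m*n c (suc e)) ⟩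
  suc e + c * suc e  ≤⟨ c·e≤s ⟩
  s                  ∎
  where open ≤-Reasoning

lookup-injective : ∀ {A : Set} {xs : List A} → Unique xs → ∀ i j → lookup xs i ≡ lookup xs j → i ≡ j
lookup-injective (_ ∷ _)  zero    zero    _ = refl
lookup-injective (x∉ ∷ _) zero    (suc j) e = ⊥-elim (All-lookup x∉ (∈-lookup j) e)
lookup-injective (x∉ ∷ _) (suc i) zero    e = ⊥-elim (All-lookup x∉ (∈-lookup i) (≡-sym e))
lookup-injective (_ ∷ u)  (suc i) (suc j) e = cong suc (lookup-injective u i j e)

module _ {G : Graph} where

  reach-end : ∀ {S : VSet G} {a b} → Reach G S a b → S b
  reach-end (here s)     = s
  reach-end (step _ _ s) = s

  reach-trans : ∀ {S : VSet G} {a b c} → Reach G S a b → Reach G S b c → Reach G S a c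
  reach-trans r (here _)      = r
  reach-trans r (step r′ e s) = step (reach-trans r r′) e s

  reach-sym : ∀ {S : VSet G} {a b} → Reach G S a b → Reach G S b a
  reach-sym (here s)     = here s
  reach-sym (step r e s) = reach-trans (step (here s) (sym G e) (reach-end r)) (reach-sym r)

  reach-mono : ∀ {S S′ : VSet G} {a b} → (∀ x → S x → S′ x) → Reach G S a b → Reach G S′ a b
  reach-mono S⊆S′ (here s)     = here (S⊆S′ _ s)
  reach-mono S⊆S′ (step r e s) = step (reach-mono S⊆S′ r) e (S⊆S′ _ s)

  reach-restrict : ∀ {S S′ : VSet G} {a b} → (∀ w → Reach G S a w → S′ w) → Reach G S a b →
    Reach G S′ a b
  reach-restrict inside (here s)     = here (inside _ (here s))
  reach-restrict inside (step r e s) = step (reach-restrict inside r) e (inside _ (step r e s))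

  component-connected : ∀ {S : VSet G} {a u v} → Reach G S a u → Reach G S a v →
    Reach G (Component G S a) u v
  component-connected ru rv = reach-trans (reach-sym (inside ru)) (inside rv)
    where
    inside : ∀ {w} → Reach G _ _ w → Reach G (Component G _ _) _ w
    inside = reach-restrict (λ _ r → r)

  private
    V : Set
    V = Fin (n G)

  open import Data.List.Membership.DecPropositional (_≟_ {n G}) using () renaming (_∈?_ to _∈ᴸ?_)

  -- Path S a b L: a path from a to b in G[S] whose vertices, listed from b back to a, are b ∷ L.
  data Path (S : VSet G) (a : V) : V → List V → Set where
    start  : S a → Path S a a []
    extend : ∀ {v w L} → Path S a v L → Adj G v w → S w → Path S a w (v ∷ L)

  path-inside : ∀ {S a b L x} → Path S a b L → x ∈ᴸ (b ∷ L) → S x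
  path-inside (start s)      (here refl)  = s
  path-inside (extend _ _ s) (here refl)  = s
  path-inside (extend p _ _) (there x∈L)  = path-inside p x∈L

  path-mono : ∀ {S S′ : VSet G} {a b L} → (∀ x → S x → S′ x) → Path S a b L → Path S′ a b L
  path-mono S⊆S′ (start s)      = start (S⊆S′ _ s)
  path-mono S⊆S′ (extend p e s) = extend (path-mono S⊆S′ p) e (S⊆S′ _ s)

  path-adjacent : ∀ {S a b L} → Path S a b L → (i : Fin (length L)) →
    Adj G (lookup (b ∷ L) (inject₁ i)) (lookup (b ∷ L) (suc i))
  path-adjacent (extend p e s) zero    = sym G e
  path-adjacent (extend p e s) (suc i) = path-adjacent p i

  path-last : ∀ {S a b L} → Path S a b L → lookup (b ∷ L) (fromℕ (length L)) ≡ a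
  path-last (start _)      = refl
  path-last (extend p _ _) = path-last p

  path-trivial : ∀ {S a b} → Path S a b [] → a ≡ b
  path-trivial (start _) = refl

  path-cut : ∀ {S a v w L} → Path S a v L → w ∈ᴸ (v ∷ L) → Unique (v ∷ L) →
    ∃ λ L′ → Path S a w L′ × Unique (w ∷ L′)
  path-cut p              (here refl) u       = _ , p , u
  path-cut (extend p _ _) (there w∈L) (_ ∷ u) = path-cut p w∈L u

  simple-path : ∀ {S a b} → Reach G S a b → ∃ λ L → Path S a b L × Unique (b ∷ L)
  simple-path (here s) = [] , start s , ([] ∷ [])
  simple-path {b = w} (step r e s) with simple-path r
  ... | L , p , u with w ∈ᴸ? (_ ∷ L)
  ...   | yes w∈ = path-cut p w∈ u
  ...   | no  w∉ = _ , extend p e s , (¬Any⇒All¬ _ w∉ ∷ u)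

  path-join : ∀ {S a b b′ c L₁ L₂} → Path S a b L₁ → Adj G b b′ → Path S b′ c L₂ →
    Path S a c (L₂ ++ (b ∷ L₁))
  path-join p e (start s)       = extend p e s
  path-join p e (extend q e′ s) = extend (path-join p e q) e′ s

  path-cycle : ∀ {W a b L} → Path W a b L → Unique (b ∷ L) → Adj G b a → 2 ≤ length L → Cycle G W
  path-cycle {b = b} {L} p u e long = record
    { m       = length L
    ; m≥2     = long
    ; c       = lookup (b ∷ L)
    ; inj     = lookup-injective u
    ; inT     = λ i → path-inside p (∈-lookup i)
    ; adj     = path-adjacent p
    ; closing = subst (λ x → Adj G x b) (≡-sym (path-last p)) (sym G e)
    }

  -- In an acyclic G[W], two disjoint connected pieces E and D cannot be joined by two edges
  -- y′u′ and uy with distinct ends y ≠ y′ in E: the two pieces and the edges form a cycle.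
  no-double-bridge : ∀ {W E D : VSet G} → Forest G W → (∀ x → E x → W x) → (∀ x → D x → W x) →
    (∀ x → E x → D x → ⊥) → ∀ {y y′ u u′} → y ≢ y′ → Reach G E y y′ → Reach G D u′ u →
    Adj G y′ u′ → Adj G u y → ⊥
  no-double-bridge {W} {E} {D} acyclic E⊆W D⊆W E∩D=∅ {y} {y′} {u} y≢y′ rE rD e₁ e₂
    with simple-path rE | simple-path rD
  ... | L₁ , p , u₁ | L₂ , q , u₂ = acyclic (path-cycle pq (++⁺ u₂ u₁ disjoint) e₂ long)
    where
    pq : Path W y u (L₂ ++ (y′ ∷ L₁))
    pq = path-join (path-mono E⊆W p) e₁ (path-mono D⊆W q)
    disjoint : ∀ {x} → ¬ (x ∈ᴸ (u ∷ L₂) × x ∈ᴸ (y′ ∷ L₁))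
    disjoint (x∈q , x∈p) = E∩D=∅ _ (path-inside p x∈p) (path-inside q x∈q)
    nontrivial : ∀ {L} → Path E y y′ L → 1 ≤ length L
    nontrivial {[]}    p′ = ⊥-elim (y≢y′ (path-trivial p′))
    nontrivial {_ ∷ _} _  = s≤s z≤n
    long : 2 ≤ length (L₂ ++ (y′ ∷ L₁))
    long = subst (2 ≤_) (≡-sym (length-++ L₂)) (≤-trans (s≤s (nontrivial p)) (m≤n+m _ (length L₂)))

-- Then (number of good j) · t ≤ |Y|: contracting every D j
-- leaves a forest in which D j has degree ≥ t + 1.
module ForestCounting {G : Graph} {W : VSet G} (acyclic : Forest G W)
  (Y : BPred (n G)) (Y⊆W : ∀ z → T (Y z) → W z)
  {c : ℕ} (good : BPred c) (D : Fin c → VSet G)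
  (D⊆W : ∀ j → T (good j) → ∀ u → D j u → W u)
  (D∩Y=∅ : ∀ j → T (good j) → ∀ u → D j u → ¬ T (Y u))
  (D-disjoint : ∀ i j → T (good i) → T (good j) → ∀ u → D i u → D j u → i ≡ j)
  (D-connected : ∀ j → T (good j) → ∀ u v → D j u → D j v → Reach G (D j) u v)
  (t : ℕ) (N : Fin c → BPred (n G))
  (N⊆Y : ∀ j → T (good j) → N j ⊆ Y)
  (N-adjacent : ∀ j → T (good j) → ∀ y → T (N j y) → ∃ λ u → D j u × Adj G y u)
  (N-large : ∀ j → T (good j) → suc t ≤ count (N j))
  where

  private
    V : Set
    V = Fin (n G)

  -- The state after merging the sets D j outside todo into Y: E is Y together with the
  -- merged sets, and rep sends each y ∈ Y to the representative in R of its E-component.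
  record Merged (todo : BPred c) : Set₁ where
    field
      E          : VSet G
      E⊆W        : ∀ x → E x → W x
      Y⊆E        : ∀ z → T (Y z) → E z
      todo-good  : todo ⊆ good
      todo-apart : ∀ j u → T (todo j) → D j u → ¬ E u
      R          : BPred (n G)
      rep        : V → V
      rep∈R      : ∀ z → T (Y z) → T (R (rep z))
      rep-reach  : ∀ z → T (Y z) → Reach G E z (rep z)

  initial : Merged good
  initial = record
    { E          = T ∘ Y
    ; E⊆W        = Y⊆W
    ; Y⊆E        = λ _ y → y
    ; todo-good  = λ _ g → g
    ; todo-apart = λ j u g du yu → D∩Y=∅ j g u du yu
    ; R          = Y
    ; rep        = id
    ; rep∈R      = λ _ y → y
    ; rep-reach  = λ _ y → here y
    }

  -- Merging one more set D j: its ≥ t + 1 neighbours have pairwise distinct representatives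
  -- (two equal ones would close a cycle through D j), and all of them but one are dropped.
  module Merge {todo : BPred c} (S : Merged todo) (j : Fin c) (todo-j : T (todo j)) where
    open Merged S

    good-j : T (good j)
    good-j = todo-good j todo-j

    N⊆Y-j : ∀ {y} → T (N j y) → T (Y y)
    N⊆Y-j {y} = N⊆Y j good-j y

    same-rep : ∀ {y y′} → T (Y y) → T (Y y′) → rep y ≡ rep y′ → Reach G E y y′
    same-rep {y} {y′} yY y′Y eq =
      reach-trans (rep-reach y yY)
        (subst (λ ρ → Reach G E ρ y′) (≡-sym eq) (reach-sym (rep-reach y′ y′Y)))

    E′ : VSet G
    E′ x = E x ⊎ D j x

    neighbour-rep? : ∀ ρ → Dec (∃ λ y → T (N j y) × rep y ≡ ρ)
    neighbour-rep? ρ = any? λ y → T? (N j y) ×-dec (rep y ≟ ρ)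

    hit : BPred (n G)
    hit ρ = does (neighbour-rep? ρ)

    hit⊆R : hit ⊆ R
    hit⊆R ρ h with does-sound (neighbour-rep? ρ) h
    ... | y , ny , refl = rep∈R y (N⊆Y-j ny)

    neighbour₀ : ∃ λ y → T (N j y)
    neighbour₀ = count-witness (N j) (≤-trans (s≤s z≤n) (N-large j good-j))

    y₀ : V
    y₀ = proj₁ neighbour₀

    y₀∈N : T (N j y₀)
    y₀∈N = proj₂ neighbour₀

    ρ₀ : V
    ρ₀ = rep y₀

    merged : BPred (n G)
    merged = hit ∖ ⁅ ρ₀ ⁆

    -- Two neighbours of D j with the same representative would be joined both inside E and
    -- through D j, a cycle in the forest G[W].
    rep-injective : ∀ {y y′} → T (N j y) → T (N j y′) → rep y ≡ rep y′ → y ≡ y′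
    rep-injective {y} {y′} ny ny′ same
      with N-adjacent j good-j y ny | N-adjacent j good-j y′ ny′
    ... | u , du , ayu | u′ , du′ , ay′u′ = decidable-stable (y ≟ y′) λ y≢y′ →
      no-double-bridge acyclic E⊆W (D⊆W j good-j) (λ x ex dx → todo-apart j x todo-j dx ex)
        y≢y′ (same-rep (N⊆Y-j ny) (N⊆Y-j ny′) same) (D-connected j good-j u′ u du′ du) ay′u′ (sym G ayu)

    removed : t ≤ count (R ∩ merged)
    removed = ≤-pred (begin
      suc t                    ≤⟨ N-large j good-j ⟩
      count (N j)              ≤⟨ count-injection (N j) hit (λ y ρ → rep y ≡ ρ)
                                    (λ y ny → rep y , rep∈hit ny , refl)
                                    (λ ny ny′ e e′ → rep-injective ny ny′ (trans e (≡-sym e′))) ⟩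
      count hit                ≡⟨ count-remove hit ρ₀∈hit ⟩
      suc (count merged)       ≤⟨ s≤s (count-mono merged⊆R∩merged) ⟩
      suc (count (R ∩ merged)) ∎)
      where
      open ≤-Reasoning
      rep∈hit : ∀ {y} → T (N j y) → T (hit (rep y))
      rep∈hit {y} ny = does-complete (neighbour-rep? (rep y)) (y , ny , refl)
      ρ₀∈hit : T (hit ρ₀)
      ρ₀∈hit = rep∈hit y₀∈N
      merged⊆R∩merged : merged ⊆ (R ∩ merged)
      merged⊆R∩merged ρ m = ∩⁺ (hit⊆R ρ (proj₁ (∖⁻ m))) m

    R′ : BPred (n G)
    R′ = R ∖ merged

    rep′ : V → V
    rep′ z = if merged (rep z) then ρ₀ else rep z

    ρ₀∈R′ : T (R′ ρ₀)
    ρ₀∈R′ = ∖⁺ (rep∈R y₀ (N⊆Y-j y₀∈N))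
               (λ m → proj₂ (∖⁻ m) (does-complete (ρ₀ ≟ ρ₀) refl))

    E⊆E′ : ∀ x → E x → E′ x
    E⊆E′ _ = inj₁

    through-D : ∀ {y y′} → T (N j y) → T (N j y′) → Reach G E′ y y′
    through-D {y} {y′} ny ny′ with N-adjacent j good-j y ny | N-adjacent j good-j y′ ny′
    ... | u , du , ayu | u′ , du′ , ay′u′ =
      step (reach-trans (step (here (inY ny)) ayu (inj₂ du))
                        (reach-mono (λ _ → inj₂) (D-connected j good-j u u′ du du′)))
           (sym G ay′u′) (inY ny′)
      where
      inY : ∀ {x} → T (N j x) → E′ x
      inY {x} nx = inj₁ (Y⊆E x (N⊆Y-j nx))

    rep′∈R′ : ∀ z → T (Y z) → T (R′ (rep′ z))
    rep′∈R′ z yz with merged (rep z) in eq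
    ... | true  = ρ₀∈R′
    ... | false = ∖⁺ (rep∈R z yz) λ m → subst T eq m

    rep′-reach : ∀ z → T (Y z) → Reach G E′ z (rep′ z)
    rep′-reach z yz with merged (rep z) in eq
    ... | false = reach-mono E⊆E′ (rep-reach z yz)
    ... | true with does-sound (neighbour-rep? (rep z)) (proj₁ (∖⁻ (Equivalence.from T-≡ eq)))
    ...   | y , ny , same =
      reach-trans (reach-mono E⊆E′ (same-rep yz (N⊆Y-j ny) (≡-sym same)))
        (reach-trans (through-D ny y₀∈N) (reach-mono E⊆E′ (rep-reach y₀ (N⊆Y-j y₀∈N))))

    next : Merged (todo ∖ ⁅ j ⁆)
    next = record
      { E          = E′
      ; E⊆W        = λ { x (inj₁ ex) → E⊆W x ex ; x (inj₂ dx) → D⊆W j good-j x dx }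
      ; Y⊆E        = λ z yz → inj₁ (Y⊆E z yz)
      ; todo-good  = λ i t → todo-good i (proj₁ (∖⁻ t))
      ; todo-apart = apart
      ; R          = R′
      ; rep        = rep′
      ; rep∈R      = rep′∈R′
      ; rep-reach  = rep′-reach
      }
      where
      apart : ∀ i u → T ((todo ∖ ⁅ j ⁆) i) → D i u → ¬ E′ u
      apart i u t di (inj₁ eu) = todo-apart i u (proj₁ (∖⁻ t)) di eu
      apart i u t di (inj₂ dj) = proj₂ (∖⁻ t) (does-complete (i ≟ j)
        (D-disjoint i j (todo-good i (proj₁ (∖⁻ t))) good-j u di dj))

    fewer : t + count R′ ≤ count R
    fewer = begin
      t + count R′                    ≤⟨ +-monoˡ-≤ (count R′) removed ⟩
      count (R ∩ merged) + count R′   ≡⟨ count-split R merged ⟨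
      count R                         ∎
      where open ≤-Reasoning

  merge-all : ∀ k {todo} → count todo ≡ k → (S : Merged todo) → k * t ≤ count (Merged.R S)
  merge-all zero    _ _ = z≤n
  merge-all (suc k) {todo} size S
    with count-witness todo (subst (0 <_) (≡-sym size) (s≤s z≤n))
  ... | j , todo-j = begin
    t + k * t                    ≤⟨ +-monoʳ-≤ t (merge-all k size′ next) ⟩
    t + count R′                 ≤⟨ fewer ⟩
    count (Merged.R S)           ∎
    where
    open Merge S j todo-j
    open ≤-Reasoning
    size′ : count (todo ∖ ⁅ j ⁆) ≡ k
    size′ = ℕ.suc-injective (trans (≡-sym (count-remove todo todo-j)) size)

  forest-count : count good * t ≤ count Y
  forest-count = merge-all (count good) refl initial

module Analysis (d : ℕ) (G : Graph) (Z X : Subset (n G))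
  (X∩Z=∅ : ∀ x → x ∈ X → x ∉ Z) (quasi-forest : QuasiForest d G (Minus G X))
  {m : ℕ} (r : Fin m → Fin (n G)) (r∉Z : ∀ i → r i ∉ Z)
  (r-distinct : ∀ i j → Component G (Minus G Z) (r i) (r j) → i ≡ j)
  (neighbours : ∀ i → AtLeastNbrsIn G (Minus G Z) (r i) Z (suc (suc d)))
  (reach-Z? : Decidable (Reach G (Minus G Z))) (reach-X? : Decidable (Reach G (Minus G X)))
  where

  C : Fin m → VSet G
  C i = Component G (Minus G Z) (r i)

  same-component : ∀ {i j u} → C i u → C j u → i ≡ j
  same-component ci cj = r-distinct _ _ (reach-trans ci (reach-sym cj))

  Nset : Fin m → Subset (n G)
  Nset i = proj₁ (neighbours i)

  N : Fin m → BPred (n G)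
  N i = ⟦ Nset i ⟧

  N⊆Z : ∀ i → N i ⊆ ⟦ Z ⟧
  N⊆Z i y ny = does-complete (y ∈? Z) (proj₁ (proj₂ (neighbours i)) y (does-sound (y ∈? Nset i) ny))

  N-adjacent : ∀ i y → T (N i y) → ∃ λ u → C i u × Adj G y u
  N-adjacent i y ny = proj₂ (proj₂ (proj₂ (neighbours i))) y (does-sound (y ∈? Nset i) ny)

  N-large : ∀ i → suc (suc d) ≤ count (N i)
  N-large i = subst (suc (suc d) ≤_) (∣∣≡count (Nset i)) (proj₁ (proj₂ (proj₂ (neighbours i))))

  -- Components meeting X: each contains its own vertex of X.
  meets-X? : ∀ i → Dec (∃ λ x → x ∈ X × C i x)
  meets-X? i = any? λ x → (x ∈? X) ×-dec reach-Z? (r i) x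

  touched : BPred m
  touched i = does (meets-X? i)

  touched-bound : count touched ≤ count ⟦ X ⟧
  touched-bound = count-injection touched ⟦ X ⟧ (λ i x → C i x)
    (λ i t → let (x , x∈X , cx) = does-sound (meets-X? i) t in x , does-complete (x ∈? X) x∈X , cx)
    (λ _ _ → same-component)

  untouched : BPred m
  untouched i = not (touched i)

  untouched-avoids-X : ∀ {i u} → T (untouched i) → C i u → u ∉ X
  untouched-avoids-X {i} {u} ut cu u∈X = T-not⁻ ut (does-complete (meets-X? i) (u , u∈X , cu))

  untouched-inside : ∀ {i u} → T (untouched i) → C i u → Reach G (Minus G X) (r i) u
  untouched-inside ut = reach-restrict (λ w cw → untouched-avoids-X ut cw)

  untouched-in-G-X : ∀ i → T (untouched i) → Reach G (Minus G X) (r i) (r i)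
  untouched-in-G-X i ut = untouched-inside ut (here (r∉Z i))

  module OneClass (i₀ : Fin m) (ut₀ : T (untouched i₀)) where

    Γ : VSet G
    Γ = Component G (Minus G X) (r i₀)

    inΓ : BPred (n G)
    inΓ x = does (reach-X? (r i₀) x)

    fvs : HasFVS d G Γ
    fvs = quasi-forest (r i₀) (untouched-avoids-X ut₀ (here (r∉Z i₀)))

    F : Subset (n G)
    F = proj₁ fvs

    Γ∖F-acyclic : Forest G (λ u → Γ u × u ∉ F)
    Γ∖F-acyclic = proj₂ (proj₂ (proj₂ fvs))

    UΓ : BPred m
    UΓ = untouched ∩ (inΓ ∘ r)

    ZΓ : BPred (n G)
    ZΓ = ⟦ Z ⟧ ∩ inΓ

    UΓ-inside : ∀ {j u} → T (UΓ j) → C j u → Γ u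
    UΓ-inside {j} uj cu =
      reach-trans (does-sound (reach-X? (r i₀) (r j)) (proj₂ (∩⁻ uj)))
                  (untouched-inside (proj₁ (∩⁻ uj)) cu)

    -- Neighbours in Z of a component inside Γ lie in Γ too, being outside X.
    N⊆ZΓ : ∀ {j} → T (UΓ j) → N j ⊆ ZΓ
    N⊆ZΓ {j} uj y ny with N-adjacent j y ny
    ... | u , cu , ayu =
      ∩⁺ (N⊆Z j y ny) (does-complete (reach-X? (r i₀) y) (step (UΓ-inside uj cu) (sym G ayu) y∉X))
      where
      y∉X : y ∉ X
      y∉X y∈X = X∩Z=∅ y y∈X (does-sound (y ∈? Z) (N⊆Z j y ny))

    a b : ℕ
    a = count (⟦ F ⟧ ∩ ⟦ Z ⟧)
    b = count (⟦ F ⟧ ∖ ⟦ Z ⟧)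

    a+b≤d : a + b ≤ d
    a+b≤d = subst (_≤ d) (trans (∣∣≡count F) (count-split ⟦ F ⟧ ⟦ Z ⟧))
                  (proj₁ (proj₂ (proj₂ fvs)))

    -- Components in Γ meeting F: each contains its own vertex of F ∖ Z.
    meets-F? : ∀ j → Dec (∃ λ u → u ∈ F × C j u)
    meets-F? j = any? λ u → (u ∈? F) ×-dec reach-Z? (r j) u

    hit : BPred m
    hit j = does (meets-F? j)

    hit-bound : count (UΓ ∩ hit) ≤ b
    hit-bound = count-injection (UΓ ∩ hit) (⟦ F ⟧ ∖ ⟦ Z ⟧) (λ j u → C j u)
      (λ j h → let (u , u∈F , cu) = does-sound (meets-F? j) (proj₂ (∩⁻ h)) in
        u , ∖⁺ (does-complete (u ∈? F) u∈F) (λ u∈Z → reach-end cu (does-sound (u ∈? Z) u∈Z)) , cu)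
      (λ _ _ → same-component)

    good : BPred m
    good = UΓ ∖ hit

    Z′ : BPred (n G)
    Z′ = ZΓ ∖ ⟦ F ⟧

    N′ : Fin m → BPred (n G)
    N′ j = N j ∖ ⟦ F ⟧

    -- At most a neighbours lie in F, so b + 2 ≤ d + 2 - a of them lie outside F.
    N′-large : ∀ {j} → T (UΓ j) → suc (suc b) ≤ count (N′ j)
    N′-large {j} uj = +-cancelˡ-≤ a _ _ (begin
      a + suc (suc b)                   ≡⟨ trans (+-suc a (suc b)) (cong suc (+-suc a b)) ⟩
      suc (suc (a + b))                 ≤⟨ s≤s (s≤s a+b≤d) ⟩
      suc (suc d)                       ≤⟨ N-large j ⟩
      count (N j)                       ≡⟨ count-split (N j) ⟦ F ⟧ ⟩
      count (N j ∩ ⟦ F ⟧) + count (N′ j) ≤⟨ +-monoˡ-≤ (count (N′ j)) (count-mono N∩F⊆F∩Z) ⟩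
      a + count (N′ j)                  ∎)
      where
      open ≤-Reasoning
      N∩F⊆F∩Z : (N j ∩ ⟦ F ⟧) ⊆ (⟦ F ⟧ ∩ ⟦ Z ⟧)
      N∩F⊆F∩Z y h = ∩⁺ (proj₂ (∩⁻ h)) (N⊆Z j y (proj₁ (∩⁻ h)))

    good-bound : count good * suc b ≤ count Z′
    good-bound = ForestCounting.forest-count Γ∖F-acyclic Z′ Z′⊆W good C D⊆W D∩Z′=∅
      (λ i j _ _ _ ci cj → same-component ci cj)
      (λ j _ _ _ cu cv → component-connected cu cv)
      (suc b) N′ N′⊆Z′ (λ j _ y ny′ → N-adjacent j y (proj₁ (∖⁻ ny′)))
      (λ j g → N′-large (proj₁ (∖⁻ g)))
      where
      Z′⊆W : ∀ z → T (Z′ z) → Γ z × z ∉ F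
      Z′⊆W z h = does-sound (reach-X? (r i₀) z) (proj₂ (∩⁻ (proj₁ (∖⁻ h))))
               , λ z∈F → proj₂ (∖⁻ h) (does-complete (z ∈? F) z∈F)
      D⊆W : ∀ j → T (good j) → ∀ u → C j u → Γ u × u ∉ F
      D⊆W j g u cu = UΓ-inside (proj₁ (∖⁻ g)) cu
                   , λ u∈F → proj₂ (∖⁻ g) (does-complete (meets-F? j) (u , u∈F , cu))
      D∩Z′=∅ : ∀ j → T (good j) → ∀ u → C j u → ¬ T (Z′ u)
      D∩Z′=∅ j _ u cu h = reach-end cu (does-sound (u ∈? Z) (proj₁ (∩⁻ (proj₁ (∖⁻ h)))))
      N′⊆Z′ : ∀ j → T (good j) → N′ j ⊆ Z′
      N′⊆Z′ j g y h = ∖⁺ (N⊆ZΓ (proj₁ (∖⁻ g)) y (proj₁ (∖⁻ h))) (proj₂ (∖⁻ h))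

    -- C i₀ itself has d + 2 neighbours in ZΓ, so b ≤ d ≤ |ZΓ|.
    b≤ZΓ : b ≤ count ZΓ
    b≤ZΓ = begin
      b              ≤⟨ m+n≤o⇒n≤o a a+b≤d ⟩
      d              ≤⟨ ≤-trans (n≤1+n d) (n≤1+n (suc d)) ⟩
      suc (suc d)    ≤⟨ N-large i₀ ⟩
      count (N i₀)   ≤⟨ count-mono (N⊆ZΓ i₀∈UΓ) ⟩
      count ZΓ       ∎
      where
      open ≤-Reasoning
      i₀∈UΓ : T (UΓ i₀)
      i₀∈UΓ = ∩⁺ ut₀ (does-complete (reach-X? (r i₀) (r i₀)) (untouched-in-G-X i₀ ut₀))

    class-bound : count UΓ ≤ count ZΓ
    class-bound = begin
      count UΓ                          ≡⟨ count-split UΓ hit ⟩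
      count (UΓ ∩ hit) + count good     ≤⟨ sum-bound hit-bound b≤ZΓ
                                             (≤-trans good-bound (count-mono Z′⊆ZΓ)) ⟩
      count ZΓ                          ∎
      where
      open ≤-Reasoning
      Z′⊆ZΓ : Z′ ⊆ ZΓ
      Z′⊆ZΓ z h = proj₁ (∖⁻ h)

  untouched-bound : count untouched ≤ count ⟦ Z ⟧
  untouched-bound = count-by-classes r reach-X? reach-sym reach-trans untouched ⟦ Z ⟧
    untouched-in-G-X OneClass.class-bound

  component-count : m ≤ ∣ X ∣ + ∣ Z ∣
  component-count = begin
    m                                          ≡⟨ count-complement touched ⟩
    count touched + count untouched            ≤⟨ +-mono-≤ touched-bound untouched-bound ⟩
    count ⟦ X ⟧ + count ⟦ Z ⟧                  ≡⟨ cong₂ _+_ (∣∣≡count X) (∣∣≡count Z) ⟨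
    ∣ X ∣ + ∣ Z ∣                              ∎
    where open ≤-Reasoning

¬¬-∀-Fin : ∀ k (P : Fin k → Set) → (∀ i → ¬ ¬ P i) → ¬ ¬ (∀ i → P i)
¬¬-∀-Fin zero    P ¬¬P ¬∀P = ¬∀P (λ ())
¬¬-∀-Fin (suc k) P ¬¬P ¬∀P = ¬¬P zero λ P₀ → ¬¬-∀-Fin k (P ∘ suc) (¬¬P ∘ suc) λ P₊ →
  ¬∀P λ { zero → P₀ ; (suc i) → P₊ i }

¬¬-decidable : ∀ {k} (R : Fin k → Fin k → Set) → ¬ ¬ Decidable R
¬¬-decidable R = ¬¬-∀-Fin _ _ λ u → ¬¬-∀-Fin _ _ λ v → ¬¬-excluded-middle

budget : ∀ {x z} k d → x ≤ k → z ≤ suc k → x + z ≤ 2 * suc k + d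
budget {x} {z} k d x≤k z≤k+1 = begin
  x + z            ≤⟨ +-mono-≤ (≤-trans x≤k (n≤1+n k)) z≤k+1 ⟩
  suc k + suc k    ≡⟨ cong (suc k +_) (+-identityʳ (suc k)) ⟨
  2 * suc k        ≤⟨ m≤m+n (2 * suc k) d ⟩
  2 * suc k + d    ∎
  where open ≤-Reasoning

-- The goal is decidable, so it may be proved under the classical assumption that
-- reachability in G - Z and in G - X is decidable; then m ≤ |X| + |Z| ≤ 2(k + 1) + d.
lemma6 : (d : ℕ) (G : Graph) (Z : Subset (n G)) (k : ℕ) →
    ∣ Z ∣ ≤ suc k → QuasiForest d G (Minus G Z) → YesInstance d G Z k →
    (m : ℕ) (r : Fin m → Fin (n G)) → (∀ i → r i ∉ Z) →
    (∀ i j → Component G (Minus G Z) (r i) (r j) → i ≡ j) →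
    (∀ i → AtLeastNbrsIn G (Minus G Z) (r i) Z (suc (suc d))) →
    m ≤ 2 * suc k + d
lemma6 d G Z k |Z|≤k+1 _ (X , |X|≤k , X∩Z=∅ , quasi-forest) m r r∉Z r-distinct neighbours =
  decidable-stable (m ≤? 2 * suc k + d) λ m≰bound →
  ¬¬-decidable (Reach G (Minus G Z)) λ reach-Z? →
  ¬¬-decidable (Reach G (Minus G X)) λ reach-X? →
  m≰bound (≤-trans
    (Analysis.component-count d G Z X X∩Z=∅ quasi-forest r r∉Z r-distinct neighbours reach-Z? reach-X?)
    (budget k d |X|≤k |Z|≤k+1))
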